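{- For every positive integer $n$, $|B_n(132,213,312)|=\lfloor (n+1)/2\rfloor$.
   Context: A permutation $\sigma\in S_n$ is written as $\sigma(1)\cdots\sigma(n)$. An index $i\in[n-1]$ is an ascent if $\sigma(i)<\sigma(i+1)$ and a descent if $\sigma(i)>\sigma(i+1)$. A ballot permutation is a permutation such that every prefix $\sigma(1)\cdots\sigma(p)$ has at least as many ascents as descents. $\sigma$ contains a pattern $\pi\in S_k$ if some subsequence $\sigma(c_1)\cdots\sigma(c_k)$ with $c_1<\dots<c_k$ is order-isomorphic to $\pi$, and avoids $\pi$ otherwise. $B_n(\pi_1,\dots,\pi_m)$ denotes the set of ballot permutations of length $n$ avoiding all of $\pi_1,\dots,\pi_m$. -}

module Defs where

open import Data.Nat using (ℕ; zero; suc; _+_; _<_; _>_; _≤_; _<ᵇ_)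
open import Data.Bool using (if_then_else_)
open import Data.Fin using (Fin; cast)
open import Data.List using (List; []; _∷_; length; lookup; take; map; upTo)
open import Data.List.Relation.Binary.Permutation.Propositional using (_↭_)
open import Data.List.Relation.Binary.Sublist.Propositional using (_⊆_)
open import Data.Product using (Σ; ∃; _×_)
open import Function.Bundles using (_⇔_)
open import Relation.Binary.PropositionalEquality using (_≡_)
open import Relation.Nullary using (¬_)

IsPerm : ℕ → List ℕ → Set
IsPerm n σ = σ ↭ map suc (upTo n)

asc : List ℕ → ℕ
asc []           = 0
asc (x ∷ [])     = 0
asc (x ∷ y ∷ r)  = (if x <ᵇ y then 1 else 0) + asc (y ∷ r)

des : List ℕ → ℕ
des []           = 0
des (x ∷ [])     = 0
des (x ∷ y ∷ r)  = (if y <ᵇ x then 1 else 0) + des (y ∷ r)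

Ballot : List ℕ → Set
Ballot σ = ∀ (p : ℕ) → des (take p σ) ≤ asc (take p σ)

OrderIso : List ℕ → List ℕ → Set
OrderIso τ π = Σ (length τ ≡ length π) λ eq →
  ∀ (i j : Fin (length τ)) →
    (lookup τ i < lookup τ j) ⇔ (lookup π (cast eq i) < lookup π (cast eq j))

Contains : List ℕ → List ℕ → Set
Contains σ π = ∃ λ τ → (τ ⊆ σ) × OrderIso τ π

Avoids : List ℕ → List ℕ → Set
Avoids σ π = ¬ Contains σ π

p132 p213 p312 : List ℕ
p132 = 1 ∷ 3 ∷ 2 ∷ []
p213 = 2 ∷ 1 ∷ 3 ∷ []
p312 = 3 ∷ 1 ∷ 2 ∷ []

InB : ℕ → List ℕ → Set
InB n σ = IsPerm n σ × Ballot σ × Avoids σ p132 × Avoids σ p213 × Avoids σ p312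

-- A permutation avoiding 132, 213 and 312 is a wedge (m+1)(m+2)⋯n m(m−1)⋯1. Indeed, deleting the
-- largest entry n leaves such a permutation, hence a wedge, and the three patterns through n force the
-- entries before n to increase, the entries after n to decrease and the former to exceed the latter; in a
-- wedge this leaves n only the two places that again produce wedges. A wedge with m < n has n−m−1 ascents,
-- all preceding its m descents, so it is a ballot permutation exactly when m ≤ n−m−1, i.e. m < ⌊(n+1)/2⌋.
module Submission where

open import Defs
open import Data.Bool using (true; false; if_then_else_)
open import Data.Bool.Properties using (T-≡)
open import Data.Empty using (⊥-elim)
open import Data.Fin using (zero; suc)
open import Data.List using (List; []; _∷_; _++_; [_]; length; take; map; upTo; applyUpTo)
open import Data.List.Properties using (∷-injective; ∷-injectiveˡ; ++-assoc; ++-identityʳ; map-++; applyUpTo-∷ʳ; take-all; length-applyUpTo)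
open import Data.List.Membership.Propositional using (_∈_)
open import Data.List.Membership.Propositional.Properties using (∈-++⁻; ∈-++⁺ˡ; ∈-++⁺ʳ; ∈-∃++; ∈-applyUpTo⁺; ∈-applyUpTo⁻)
open import Data.List.Relation.Unary.Any using (here; there)
open import Data.List.Relation.Unary.Unique.Propositional using (Unique)
open import Data.List.Relation.Unary.Unique.Propositional.Properties using (applyUpTo⁺₁)
open import Data.List.Relation.Binary.Sublist.Propositional using (_⊆_; []; _∷_; _∷ʳ_; ⊆-refl; ⊆-trans; from∈; to∈)
  renaming (lookup to ⊆-lookup)
open import Data.List.Relation.Binary.Sublist.Propositional.Properties using ([]⊆-universal; ++⁺; ++⁺ˡ)
open import Data.List.Relation.Binary.Permutation.Propositional using (_↭_; ↭-refl; ↭-prep; ↭-sym; module PermutationReasoning)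
open import Data.List.Relation.Binary.Permutation.Propositional.Properties using (↭-singleton-inv; ∈-resp-↭; drop-mid; ∷↭∷ʳ)
  renaming (++⁺ˡ to ↭-++⁺ˡ; ++-comm to ↭-++-comm)
open import Data.Nat using (ℕ; zero; suc; _+_; _∸_; _≤_; _<_; _<ᵇ_; z≤n; s≤s; z<s; s<s; ⌊_/2⌋)
open import Data.Nat.Properties
open import Data.Product using (∃; ∃₂; _×_; _,_; proj₁; proj₂)
open import Data.Sum using (_⊎_; inj₁; inj₂; [_,_]′)
open import Function using (id; _∘_)
open import Function.Bundles using (_⇔_; mk⇔; Equivalence)
open import Function.Construct.Composition using (_⇔-∘_)
open import Function.Construct.Symmetry using (⇔-sym)
open import Relation.Binary.PropositionalEquality using (_≡_; _≢_; refl; sym; trans; cong; subst; subst₂; module ≡-Reasoning)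

open Equivalence using (to; from)

-- Patterns of length three

SameOrder : ℕ → ℕ → ℕ → ℕ → Set
SameOrder a b p q = (a < b × p < q) ⊎ (b < a × q < p)

sameOrder-<⇔< : ∀ {a b p q} → SameOrder a b p q → (a < b ⇔ p < q)
sameOrder-<⇔< (inj₁ (a<b , p<q)) = mk⇔ (λ _ → p<q) (λ _ → a<b)
sameOrder-<⇔< (inj₂ (b<a , q<p)) = mk⇔ (λ a<b → ⊥-elim (<-asym a<b b<a)) (λ p<q → ⊥-elim (<-asym p<q q<p))

sameOrder-sym : ∀ {a b p q} → SameOrder a b p q → SameOrder b a q p
sameOrder-sym (inj₁ lt) = inj₂ lt
sameOrder-sym (inj₂ gt) = inj₁ gt

<-irrefl⇔ : ∀ {a p} → (a < a ⇔ p < p)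
<-irrefl⇔ = mk⇔ (⊥-elim ∘ <-irrefl refl) (⊥-elim ∘ <-irrefl refl)

orderIso₃ : ∀ {a b c p q r} → SameOrder a b p q → SameOrder a c p r → SameOrder b c q r →
  OrderIso (a ∷ b ∷ c ∷ []) (p ∷ q ∷ r ∷ [])
orderIso₃ ab ac bc = refl , λ where
  zero             zero             → <-irrefl⇔
  zero             (suc zero)       → sameOrder-<⇔< ab
  zero             (suc (suc zero)) → sameOrder-<⇔< ac
  (suc zero)       zero             → sameOrder-<⇔< (sameOrder-sym ab)
  (suc zero)       (suc zero)       → <-irrefl⇔
  (suc zero)       (suc (suc zero)) → sameOrder-<⇔< bc
  (suc (suc zero)) zero             → sameOrder-<⇔< (sameOrder-sym ac)
  (suc (suc zero)) (suc zero)       → sameOrder-<⇔< (sameOrder-sym bc)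
  (suc (suc zero)) (suc (suc zero)) → <-irrefl⇔

Occurrence : (ℕ → ℕ → ℕ → Set) → List ℕ → Set
Occurrence R σ = ∃ λ a → ∃ λ b → ∃ λ c → a ∷ b ∷ c ∷ [] ⊆ σ × R a b c

Shape132 Shape213 Shape312 : ℕ → ℕ → ℕ → Set
Shape132 a b c = a < c × c < b
Shape213 a b c = b < a × a < c
Shape312 a b c = b < c × c < a

contains132⇔ : ∀ {σ} → Contains σ p132 ⇔ Occurrence Shape132 σ
contains132⇔ = mk⇔
  (λ { ((a ∷ b ∷ c ∷ []) , s , _ , iso) →
       a , b , c , s , from (iso zero (suc (suc zero))) (s<s z<s) ,
                       from (iso (suc (suc zero)) (suc zero)) (s<s (s<s z<s)) })
  (λ { (a , b , c , s , a<c , c<b) →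
       _ , s , orderIso₃ (inj₁ (<-trans a<c c<b , s<s z<s))
                         (inj₁ (a<c , s<s z<s))
                         (inj₂ (c<b , s<s (s<s z<s))) })

contains213⇔ : ∀ {σ} → Contains σ p213 ⇔ Occurrence Shape213 σ
contains213⇔ = mk⇔
  (λ { ((a ∷ b ∷ c ∷ []) , s , _ , iso) →
       a , b , c , s , from (iso (suc zero) zero) (s<s z<s) ,
                       from (iso zero (suc (suc zero))) (s<s (s<s z<s)) })
  (λ { (a , b , c , s , b<a , a<c) →
       _ , s , orderIso₃ (inj₂ (b<a , s<s z<s))
                         (inj₁ (a<c , s<s (s<s z<s)))
                         (inj₁ (<-trans b<a a<c , s<s z<s)) })

contains312⇔ : ∀ {σ} → Contains σ p312 ⇔ Occurrence Shape312 σ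
contains312⇔ = mk⇔
  (λ { ((a ∷ b ∷ c ∷ []) , s , _ , iso) →
       a , b , c , s , from (iso (suc zero) (suc (suc zero))) (s<s z<s) ,
                       from (iso (suc (suc zero)) zero) (s<s (s<s z<s)) })
  (λ { (a , b , c , s , b<c , c<a) →
       _ , s , orderIso₃ (inj₂ (<-trans b<c c<a , s<s z<s))
                         (inj₂ (c<a , s<s (s<s z<s)))
                         (inj₁ (b<c , s<s z<s)) })

avoids-⊆ : ∀ {τ σ} π → τ ⊆ σ → Avoids σ π → Avoids τ π
avoids-⊆ π τ⊆σ av (ρ , ρ⊆τ , iso) = av (ρ , ⊆-trans ρ⊆τ τ⊆σ , iso)

Avoids₃ : List ℕ → Set
Avoids₃ σ = Avoids σ p132 × Avoids σ p213 × Avoids σ p312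

avoids₃-⊆ : ∀ {τ σ} → τ ⊆ σ → Avoids₃ σ → Avoids₃ τ
avoids₃-⊆ τ⊆σ (av132 , av213 , av312) =
  avoids-⊆ p132 τ⊆σ av132 , avoids-⊆ p213 τ⊆σ av213 , avoids-⊆ p312 τ⊆σ av312

module _ {a b c : ℕ} where
  first-third : a ∷ c ∷ [] ⊆ a ∷ b ∷ c ∷ []
  first-third = refl ∷ b ∷ʳ refl ∷ []

  first-second : a ∷ b ∷ [] ⊆ a ∷ b ∷ c ∷ []
  first-second = refl ∷ refl ∷ c ∷ʳ []

  second-third : b ∷ c ∷ [] ⊆ a ∷ b ∷ c ∷ []
  second-third = a ∷ʳ refl ∷ refl ∷ []

pair-++ : ∀ (X : List ℕ) {Y u v} → u ∷ v ∷ [] ⊆ X ++ Y →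
  (u ∷ v ∷ [] ⊆ X) ⊎ (u ∈ X × v ∈ Y) ⊎ (u ∷ v ∷ [] ⊆ Y)
pair-++ []      p         = inj₂ (inj₂ p)
pair-++ (x ∷ X) (.x ∷ʳ p) with pair-++ X p
... | inj₁ q                = inj₁ (x ∷ʳ q)
... | inj₂ (inj₁ (u∈ , v∈)) = inj₂ (inj₁ (there u∈ , v∈))
... | inj₂ (inj₂ q)         = inj₂ (inj₂ q)
pair-++ (x ∷ X) (refl ∷ q) with ∈-++⁻ X (to∈ q)
... | inj₁ v∈X = inj₁ (refl ∷ from∈ v∈X)
... | inj₂ v∈Y = inj₂ (inj₁ (here refl , v∈Y))

++≡++-cases : ∀ {a} {X : Set a} (A B U D : List X) → A ++ B ≡ U ++ D →
  (A ≡ U × B ≡ D)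
  ⊎ (∃₂ λ c C → A ≡ U ++ c ∷ C × D ≡ c ∷ C ++ B)
  ⊎ (∃₂ λ c C → U ≡ A ++ c ∷ C × B ≡ c ∷ C ++ D)
++≡++-cases []      B []      D e = inj₁ (refl , e)
++≡++-cases []      B (u ∷ U) D e = inj₂ (inj₂ (u , U , refl , e))
++≡++-cases (a ∷ A) B []      D e = inj₂ (inj₁ (a , A , refl , sym e))
++≡++-cases (a ∷ A) B (u ∷ U) D e with ∷-injective e
... | refl , e′ with ++≡++-cases A B U D e′
...   | inj₁ (refl , B≡D)               = inj₁ (refl , B≡D)
...   | inj₂ (inj₁ (c , C , refl , D≡)) = inj₂ (inj₁ (c , C , refl , D≡))
...   | inj₂ (inj₂ (c , C , refl , B≡)) = inj₂ (inj₂ (c , C , refl , B≡))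

pair-∷-++ : ∀ {x y : ℕ} P {Q} → x ∷ y ∷ [] ⊆ x ∷ P ++ y ∷ Q
pair-∷-++ P = refl ∷ from∈ (∈-++⁺ʳ P (here refl))

take-++ˡ : ∀ p (xs ys : List ℕ) → p ≤ length xs → take p (xs ++ ys) ≡ take p xs
take-++ˡ zero    xs       ys _         = refl
take-++ˡ (suc p) (x ∷ xs) ys (s≤s p≤n) = cong (x ∷_) (take-++ˡ p xs ys p≤n)

<ᵇ-true : ∀ {m n} → m < n → (m <ᵇ n) ≡ true
<ᵇ-true m<n = to T-≡ (<⇒<ᵇ m<n)

<ᵇ-false : ∀ {m n} → n ≤ m → (m <ᵇ n) ≡ false
<ᵇ-false {zero}  {zero}  _         = refl
<ᵇ-false {suc m} {zero}  _         = refl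
<ᵇ-false {suc m} {suc n} (s≤s n≤m) = <ᵇ-false n≤m

module _ {x y : ℕ} (r : List ℕ) where
  asc-∷-< : x < y → asc (x ∷ y ∷ r) ≡ suc (asc (y ∷ r))
  asc-∷-< x<y rewrite <ᵇ-true x<y = refl

  asc-∷-≥ : y ≤ x → asc (x ∷ y ∷ r) ≡ asc (y ∷ r)
  asc-∷-≥ y≤x rewrite <ᵇ-false y≤x = refl

  des-∷-> : y < x → des (x ∷ y ∷ r) ≡ suc (des (y ∷ r))
  des-∷-> y<x rewrite <ᵇ-true y<x = refl

  des-∷-≤ : x ≤ y → des (x ∷ y ∷ r) ≡ des (y ∷ r)
  des-∷-≤ x≤y rewrite <ᵇ-false x≤y = refl

des-take-≤ : ∀ p xs → des (take p xs) ≤ des xs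
des-take-≤ zero          xs          = z≤n
des-take-≤ (suc p)       []          = z≤n
des-take-≤ (suc zero)    (x ∷ xs)    = z≤n
des-take-≤ (suc (suc p)) (x ∷ [])    = z≤n
des-take-≤ (suc (suc p)) (x ∷ y ∷ r) = +-monoʳ-≤ (if y <ᵇ x then 1 else 0) (des-take-≤ (suc p) (y ∷ r))

asc-≤-take-++ : ∀ p xs ys → length xs ≤ p → asc xs ≤ asc (take p (xs ++ ys))
asc-≤-take-++ p             []          ys _                 = z≤n
asc-≤-take-++ p             (x ∷ [])    ys _                 = z≤n
asc-≤-take-++ (suc (suc p)) (x ∷ y ∷ r) ys (s≤s (s≤s len≤p)) =
  +-monoʳ-≤ (if x <ᵇ y then 1 else 0) (asc-≤-take-++ (suc p) (y ∷ r) ys (s≤s len≤p))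

-- Runs and wedges

ascRun : ℕ → ℕ → List ℕ
ascRun b zero    = []
ascRun b (suc k) = suc b ∷ ascRun (suc b) k

descRun : ℕ → List ℕ
descRun zero    = []
descRun (suc m) = suc m ∷ descRun m

wedge : ℕ → ℕ → List ℕ
wedge m k = ascRun m k ++ descRun m

ascRun-snoc : ∀ b k → ascRun b (suc k) ≡ ascRun b k ++ [ suc (b + k) ]
ascRun-snoc b zero    = cong (λ x → [ suc x ]) (sym (+-identityʳ b))
ascRun-snoc b (suc k) rewrite +-suc b k = cong (suc b ∷_) (ascRun-snoc (suc b) k)

ascRun-++ : ∀ b j k → ascRun b (j + k) ≡ ascRun b j ++ ascRun (b + j) k
ascRun-++ b zero    k rewrite +-identityʳ b = refl
ascRun-++ b (suc j) k rewrite +-suc b j = cong (suc b ∷_) (ascRun-++ (suc b) j k)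

length-ascRun : ∀ b k → length (ascRun b k) ≡ k
length-ascRun b zero    = refl
length-ascRun b (suc k) = cong suc (length-ascRun (suc b) k)

∈-ascRun : ∀ {x} b k → x ∈ ascRun b k → b < x × x ≤ b + k
∈-ascRun b (suc k) (here refl) = n<1+n b , m<m+n b z<s
∈-ascRun {x} b (suc k) (there x∈) with ∈-ascRun (suc b) k x∈
... | b<x , x≤ = <-trans (n<1+n b) b<x , ≤-trans x≤ (≤-reflexive (sym (+-suc b k)))

∈-descRun : ∀ {x} m → x ∈ descRun m → x ≤ m
∈-descRun (suc m) (here refl) = ≤-refl
∈-descRun (suc m) (there x∈)  = m≤n⇒m≤1+n (∈-descRun m x∈)

upTo-ascRun : ∀ n → map suc (upTo n) ≡ ascRun 0 n
upTo-ascRun zero    = refl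
upTo-ascRun (suc n) = begin
  map suc (upTo (suc n))         ≡⟨ cong (map suc) (sym (applyUpTo-∷ʳ id n)) ⟩
  map suc (upTo n ++ [ n ])      ≡⟨ map-++ suc (upTo n) [ n ] ⟩
  map suc (upTo n) ++ [ suc n ]  ≡⟨ cong (_++ [ suc n ]) (upTo-ascRun n) ⟩
  ascRun 0 n ++ [ suc n ]        ≡⟨ sym (ascRun-snoc 0 n) ⟩
  ascRun 0 (suc n)               ∎
  where open ≡-Reasoning

descRun-↭ : ∀ m → descRun m ↭ ascRun 0 m
descRun-↭ zero    = ↭-refl
descRun-↭ (suc m) = begin
  suc m ∷ descRun m        ↭⟨ ↭-prep (suc m) (descRun-↭ m) ⟩
  suc m ∷ ascRun 0 m       ↭⟨ ∷↭∷ʳ (suc m) (ascRun 0 m) ⟩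
  ascRun 0 m ++ [ suc m ]  ≡⟨ sym (ascRun-snoc 0 m) ⟩
  ascRun 0 (suc m)         ∎
  where open PermutationReasoning

wedge-↭ : ∀ m k → wedge m k ↭ ascRun 0 (m + k)
wedge-↭ m k = begin
  ascRun m k ++ descRun m    ↭⟨ ↭-++⁺ˡ (ascRun m k) (descRun-↭ m) ⟩
  ascRun m k ++ ascRun 0 m   ↭⟨ ↭-++-comm (ascRun m k) (ascRun 0 m) ⟩
  ascRun 0 m ++ ascRun m k   ≡⟨ sym (ascRun-++ 0 m k) ⟩
  ascRun 0 (m + k)           ∎
  where open PermutationReasoning

pair-ascRun : ∀ {u v} b k → u ∷ v ∷ [] ⊆ ascRun b k → u < v
pair-ascRun b (suc k) (_ ∷ʳ p)   = pair-ascRun (suc b) k p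
pair-ascRun b (suc k) (refl ∷ p) = proj₁ (∈-ascRun (suc b) k (to∈ p))

pair-descRun : ∀ {u v} m → u ∷ v ∷ [] ⊆ descRun m → v < u
pair-descRun (suc m) (_ ∷ʳ p)   = pair-descRun m p
pair-descRun (suc m) (refl ∷ p) = s≤s (∈-descRun m (to∈ p))

pair-wedge : ∀ {u v} m k → u ∷ v ∷ [] ⊆ wedge m k → (m < u × u < v) ⊎ (v ≤ m × v < u)
pair-wedge m k p with pair-++ (ascRun m k) p
... | inj₁ q = inj₁ (proj₁ (∈-ascRun m k (⊆-lookup q (here refl))) , pair-ascRun m k q)
... | inj₂ (inj₁ (u∈ , v∈)) =
  inj₂ (∈-descRun m v∈ , ≤-<-trans (∈-descRun m v∈) (proj₁ (∈-ascRun m k u∈)))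
... | inj₂ (inj₂ q) = inj₂ (∈-descRun m (⊆-lookup q (there (here refl))) , pair-descRun m q)

wedge-suc : ∀ m k → ascRun m k ++ suc (m + k) ∷ descRun m ≡ wedge m (suc k)
wedge-suc m k = begin
  ascRun m k ++ [ suc (m + k) ] ++ descRun m    ≡⟨ sym (++-assoc (ascRun m k) [ suc (m + k) ] (descRun m)) ⟩
  (ascRun m k ++ [ suc (m + k) ]) ++ descRun m  ≡⟨ cong (_++ descRun m) (sym (ascRun-snoc m k)) ⟩
  wedge m (suc k)                               ∎
  where open ≡-Reasoning

des-ascRun : ∀ b k → des (ascRun b k) ≡ 0
des-ascRun b zero          = refl
des-ascRun b (suc zero)    = refl
des-ascRun b (suc (suc k)) =
  trans (des-∷-≤ (ascRun (suc (suc b)) k) (n≤1+n (suc b))) (des-ascRun (suc b) (suc k))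

asc-ascRun : ∀ b k → asc (ascRun b (suc k)) ≡ k
asc-ascRun b zero    = refl
asc-ascRun b (suc k) =
  trans (asc-∷-< (ascRun (suc (suc b)) k) (n<1+n (suc b))) (cong suc (asc-ascRun (suc b) k))

asc-descRun : ∀ m → asc (descRun m) ≡ 0
asc-descRun zero          = refl
asc-descRun (suc zero)    = refl
asc-descRun (suc (suc m)) = trans (asc-∷-≥ (descRun m) (n≤1+n (suc m))) (asc-descRun (suc m))

des-descRun : ∀ m → des (descRun (suc m)) ≡ m
des-descRun zero    = refl
des-descRun (suc m) = trans (des-∷-> (descRun m) (n<1+n (suc m))) (cong suc (des-descRun m))

asc-ascRun++descRun : ∀ b k {m} → m ≤ b → asc (ascRun b (suc k) ++ descRun m) ≡ k
asc-ascRun++descRun b zero    {zero}  _   = refl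
asc-ascRun++descRun b zero    {suc m} m<b =
  trans (asc-∷-≥ (descRun m) (m≤n⇒m≤1+n m<b)) (asc-descRun (suc m))
asc-ascRun++descRun b (suc k)         m≤b =
  trans (asc-∷-< (ascRun (suc (suc b)) k ++ descRun _) (n<1+n (suc b)))
        (cong suc (asc-ascRun++descRun (suc b) k (m≤n⇒m≤1+n m≤b)))

des-ascRun++descRun : ∀ b k {m} → m ≤ b → des (ascRun b (suc k) ++ descRun m) ≡ m
des-ascRun++descRun b zero    {zero}  _   = refl
des-ascRun++descRun b zero    {suc m} m<b =
  trans (des-∷-> (descRun m) (s≤s m<b)) (cong suc (des-descRun m))
des-ascRun++descRun b (suc k)         m≤b =
  trans (des-∷-≤ (ascRun (suc (suc b)) k ++ descRun _) (n≤1+n (suc b)))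
        (des-ascRun++descRun (suc b) k (m≤n⇒m≤1+n m≤b))

-- Wedges are ballot avoiders

wedge-avoids132 : ∀ m k → Avoids (wedge m k) p132
wedge-avoids132 m k occ with to contains132⇔ occ
... | a , b , c , s , a<c , c<b
  with pair-wedge m k (⊆-trans first-third s) | pair-wedge m k (⊆-trans second-third s)
... | inj₂ (_ , c<a)   | _                = <-asym a<c c<a
... | inj₁ _           | inj₁ (_ , b<c)   = <-asym b<c c<b
... | inj₁ (m<a , _)   | inj₂ (c≤m , _)   = <-asym a<c (≤-<-trans c≤m m<a)

wedge-avoids213 : ∀ m k → Avoids (wedge m k) p213
wedge-avoids213 m k occ with to contains213⇔ occ
... | a , b , c , s , b<a , a<c
  with pair-wedge m k (⊆-trans second-third s) | pair-wedge m k (⊆-trans first-second s)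
... | inj₂ (_ , c<b)   | _                = <-asym c<b (<-trans b<a a<c)
... | inj₁ _           | inj₁ (_ , a<b)   = <-asym a<b b<a
... | inj₁ (m<b , _)   | inj₂ (b≤m , _)   = <⇒≱ m<b b≤m

wedge-avoids312 : ∀ m k → Avoids (wedge m k) p312
wedge-avoids312 m k occ with to contains312⇔ occ
... | a , b , c , s , b<c , c<a
  with pair-wedge m k (⊆-trans second-third s) | pair-wedge m k (⊆-trans first-second s)
... | inj₂ (_ , c<b)   | _                = <-asym c<b b<c
... | inj₁ _           | inj₁ (_ , a<b)   = <-asym a<b (<-trans b<c c<a)
... | inj₁ (m<b , _)   | inj₂ (b≤m , _)   = <⇒≱ m<b b≤m

wedge-ballot : ∀ {m k} → m ≤ k → Ballot (wedge m (suc k))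
wedge-ballot {m} {k} m≤k p = [ inside-run , past-run ]′ (≤-<-connex p (suc k))
  where
  open ≤-Reasoning
  U = ascRun m (suc k)
  w = wedge m (suc k)
  |U|≡ : length U ≡ suc k
  |U|≡ = length-ascRun m (suc k)
  inside-run : p ≤ suc k → des (take p w) ≤ asc (take p w)
  inside-run p≤1+k = begin
    des (take p w)   ≡⟨ cong des (take-++ˡ p U (descRun m) (≤-trans p≤1+k (≤-reflexive (sym |U|≡)))) ⟩
    des (take p U)   ≤⟨ des-take-≤ p U ⟩
    des U            ≡⟨ des-ascRun m (suc k) ⟩
    0                ≤⟨ z≤n ⟩
    asc (take p w)   ∎
  past-run : suc k < p → des (take p w) ≤ asc (take p w)
  past-run 1+k<p = begin
    des (take p w)   ≤⟨ des-take-≤ p w ⟩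
    des w            ≡⟨ des-ascRun++descRun m k ≤-refl ⟩
    m                ≤⟨ m≤k ⟩
    k                ≡⟨ sym (asc-ascRun m k) ⟩
    asc U            ≤⟨ asc-≤-take-++ p U (descRun m) (≤-trans (≤-reflexive |U|≡) (<⇒≤ 1+k<p)) ⟩
    asc (take p w)   ∎

ballot-wedge : ∀ {m k} → Ballot (wedge m (suc k)) → m ≤ k
ballot-wedge {m} {k} bal = begin
  m                        ≡⟨ sym (des-ascRun++descRun m k ≤-refl) ⟩
  des w                    ≡⟨ cong des (sym (take-all (length w) w ≤-refl)) ⟩
  des (take (length w) w)  ≤⟨ bal (length w) ⟩
  asc (take (length w) w)  ≡⟨ cong asc (take-all (length w) w ≤-refl) ⟩
  asc w                    ≡⟨ asc-ascRun++descRun m k ≤-refl ⟩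
  k                        ∎
  where w = wedge m (suc k)
        open ≤-Reasoning

wedge-InB : ∀ {m k} → m ≤ k → InB (m + suc k) (wedge m (suc k))
wedge-InB {m} {k} m≤k =
  subst (wedge m (suc k) ↭_) (sym (upTo-ascRun (m + suc k))) (wedge-↭ m (suc k)) ,
  wedge-ballot m≤k , wedge-avoids132 m (suc k) , wedge-avoids213 m (suc k) , wedge-avoids312 m (suc k)

-- Avoiders are wedges

Ascending Descending : List ℕ → Set
Ascending xs  = ∀ {x y} → x ∷ y ∷ [] ⊆ xs → x ≤ y
Descending xs = ∀ {x y} → x ∷ y ∷ [] ⊆ xs → y ≤ x

Above : List ℕ → List ℕ → Set
Above xs ys = ∀ {x y} → x ∈ xs → y ∈ ys → y ≤ x

-- A must end exactly where the ascending run ends, unless A is empty and that run has a single entry.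
insert-peak : ∀ {A B} m k → Ascending A → Descending B → Above A B → A ++ B ≡ wedge m (suc k) →
  ∃₂ λ m′ k′ → m′ + suc k′ ≡ suc (m + suc k) × A ++ suc (m + suc k) ∷ B ≡ wedge m′ (suc k′)
insert-peak {[]} m zero    _ _    _ refl = suc m , 0 , refl , cong (λ x → suc x ∷ suc m ∷ descRun m) (+-comm m 1)
insert-peak {[]} m (suc k) _ desc _ refl = ⊥-elim (1+n≰n (desc (refl ∷ refl ∷ []⊆-universal _)))
insert-peak {a ∷ A} {B} m k ascA _ above e with ++≡++-cases (a ∷ A) B (ascRun m (suc k)) (descRun m) e
... | inj₁ (refl , refl) = m , suc k , +-suc m (suc k) , wedge-suc m (suc k)
... | inj₂ (inj₁ (c , C , refl , D≡)) =
  ⊥-elim (1+n≰n (≤-trans (ascA (pair-∷-++ (ascRun (suc m) k))) (∈-descRun m (subst (c ∈_) (sym D≡) (here refl)))))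
... | inj₂ (inj₂ (c , C , U≡ , refl)) =
  ⊥-elim (<⇒≱ (pair-ascRun m (suc k) (subst (a ∷ c ∷ [] ⊆_) (sym U≡) (pair-∷-++ A))) (above (here refl) (here refl)))

-- Otherwise N would complete an occurrence of 213, 312 or 132 respectively.
avoider-around-max : ∀ A B {N} → (∀ {x} → x ∈ A ++ B → x < N) → Avoids₃ (A ++ N ∷ B) →
  Ascending A × Descending B × Above A B
avoider-around-max A B below (av132 , av213 , av312) = ascA , descB , above
  where
  ascA : Ascending A
  ascA {x} {y} xy⊆ = ≮⇒≥ λ y<x → av213 (from contains213⇔
    (x , y , _ , ++⁺ xy⊆ (refl ∷ []⊆-universal B) , y<x , below (∈-++⁺ˡ (⊆-lookup xy⊆ (here refl)))))
  descB : Descending B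
  descB {x} {y} xy⊆ = ≮⇒≥ λ x<y → av312 (from contains312⇔
    (_ , x , y , ++⁺ˡ A (refl ∷ xy⊆) , x<y , below (∈-++⁺ʳ A (⊆-lookup xy⊆ (there (here refl))))))
  above : Above A B
  above {x} {y} x∈A y∈B = ≮⇒≥ λ x<y → av132 (from contains132⇔
    (x , _ , y , ++⁺ (from∈ x∈A) (refl ∷ from∈ y∈B) , x<y , below (∈-++⁺ʳ A y∈B)))

1+n∈ascRun : ∀ n → suc n ∈ ascRun 0 (suc n)
1+n∈ascRun n = subst (suc n ∈_) (sym (ascRun-snoc 0 n)) (∈-++⁺ʳ (ascRun 0 n) (here refl))

drop-max : ∀ A B {n} → A ++ suc n ∷ B ↭ ascRun 0 (suc n) → A ++ B ↭ ascRun 0 n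
drop-max A B {n} p = subst (A ++ B ↭_) (++-identityʳ (ascRun 0 n))
  (drop-mid A (ascRun 0 n) (subst (A ++ suc n ∷ B ↭_) (ascRun-snoc 0 n) p))

IsWedge : ℕ → List ℕ → Set
IsWedge n σ = ∃₂ λ m k → m + suc k ≡ n × σ ≡ wedge m (suc k)

avoider-wedge : ∀ n {σ} → σ ↭ ascRun 0 (suc n) → Avoids₃ σ → IsWedge (suc n) σ
avoider-wedge zero    σ↭ _  = 0 , 0 , refl , ↭-singleton-inv σ↭
avoider-wedge (suc n) σ↭ av with ∈-∃++ (∈-resp-↭ (↭-sym σ↭) (1+n∈ascRun (suc n)))
... | A , B , refl
  with AB↭ ← drop-max A B σ↭
  with m , k , e , AB≡ ← avoider-wedge n AB↭ (avoids₃-⊆ (++⁺ ⊆-refl (_ ∷ʳ ⊆-refl)) av)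
  with ascA , descB , above ← avoider-around-max A B (s≤s ∘ proj₂ ∘ ∈-ascRun 0 (suc n) ∘ ∈-resp-↭ AB↭) av
  with m′ , k′ , e′ , AnB≡ ← insert-peak m k ascA descB above AB≡
  = m′ , k′ , trans e′ (cong suc e) , subst (λ N → A ++ N ∷ B ≡ wedge m′ (suc k′)) (cong suc e) AnB≡

InB⇒wedge : ∀ n {σ} → InB (suc n) σ → ∃₂ λ m k → m ≤ k × m + suc k ≡ suc n × σ ≡ wedge m (suc k)
InB⇒wedge n {σ} (σ↭ , bal , av) with avoider-wedge n (subst (σ ↭_) (upTo-ascRun (suc n)) σ↭) av
... | m , k , e , refl = m , k , ballot-wedge bal , e , refl

-- Counting

m<⌊1+n/2⌋⁻ : ∀ m n → m < ⌊ suc n /2⌋ → ∃ λ k → m ≤ k × m + suc k ≡ n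
m<⌊1+n/2⌋⁻ zero    (suc n)       _         = n , z≤n , refl
m<⌊1+n/2⌋⁻ (suc m) (suc (suc n)) (s≤s m<) with m<⌊1+n/2⌋⁻ m n m<
... | k , m≤k , e = suc k , s≤s m≤k , cong suc (trans (+-suc m (suc k)) (cong suc e))

m<⌊1+n/2⌋⁺ : ∀ m k → m ≤ k → m < ⌊ suc (m + suc k) /2⌋
m<⌊1+n/2⌋⁺ zero    k       _         = z<s
m<⌊1+n/2⌋⁺ (suc m) (suc k) (s≤s m≤k) =
  subst (λ x → suc m < suc ⌊ x /2⌋) (sym (+-suc m (suc k))) (s<s (m<⌊1+n/2⌋⁺ m k m≤k))

m<⌊1+n/2⌋⇔ : ∀ {m n} → m < ⌊ suc n /2⌋ ⇔ (∃ λ k → m ≤ k × m + suc k ≡ n)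
m<⌊1+n/2⌋⇔ {m} {n} = mk⇔ (m<⌊1+n/2⌋⁻ m n) λ { (k , m≤k , refl) → m<⌊1+n/2⌋⁺ m k m≤k }

wedge-∸ : ∀ {m k n} → m + suc k ≡ n → wedge m (n ∸ m) ≡ wedge m (suc k)
wedge-∸ {m} {k} refl = cong (wedge m) (m+n∸m≡n m (suc k))

InB⇔wedge : ∀ {n σ} → 1 ≤ n → InB n σ ⇔ (∃ λ m → m < ⌊ suc n /2⌋ × σ ≡ wedge m (n ∸ m))
InB⇔wedge {suc n} _ = mk⇔
  (λ σ∈B → let (m , k , m≤k , e , σ≡) = InB⇒wedge n σ∈B in
    m , from m<⌊1+n/2⌋⇔ (k , m≤k , e) , trans σ≡ (sym (wedge-∸ e)))
  (λ { (m , lt , refl) → let (k , m≤k , e) = to m<⌊1+n/2⌋⇔ lt in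
    subst₂ InB e (sym (wedge-∸ e)) (wedge-InB m≤k) })

wedge-injectiveˡ : ∀ {m m′ k k′} → wedge m (suc k) ≡ wedge m′ (suc k′) → m ≡ m′
wedge-injectiveˡ = suc-injective ∘ ∷-injectiveˡ

wedge-∸-injective : ∀ {n i j} → i < ⌊ suc n /2⌋ → j < ⌊ suc n /2⌋ → wedge i (n ∸ i) ≡ wedge j (n ∸ j) → i ≡ j
wedge-∸-injective i< j< e with _ , _ , ei ← to m<⌊1+n/2⌋⇔ i< with _ , _ , ej ← to m<⌊1+n/2⌋⇔ j< =
  wedge-injectiveˡ (trans (sym (wedge-∸ ei)) (trans e (wedge-∸ ej)))

∈-applyUpTo⇔ : ∀ {a} {X : Set a} (f : ℕ → X) {n x} → x ∈ applyUpTo f n ⇔ (∃ λ i → i < n × x ≡ f i)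
∈-applyUpTo⇔ f = mk⇔ (∈-applyUpTo⁻ f) λ { (i , i<n , refl) → ∈-applyUpTo⁺ f i<n }

theorem4p4 : ∀ (n : ℕ) → 1 ≤ n →
    ∃ λ (L : List (List ℕ)) →
      Unique L × (∀ σ → (σ ∈ L) ⇔ InB n σ) × (length L ≡ ⌊ suc n /2⌋)
theorem4p4 n 1≤n = applyUpTo w h , applyUpTo⁺₁ w h distinct , members , length-applyUpTo w h
  where
  h : ℕ
  h = ⌊ suc n /2⌋
  w : ℕ → List ℕ
  w m = wedge m (n ∸ m)
  distinct : ∀ {i j} → i < j → j < h → w i ≢ w j
  distinct i<j j<h e = <-irrefl (wedge-∸-injective (<-trans i<j j<h) j<h e) i<j
  members : ∀ σ → σ ∈ applyUpTo w h ⇔ InB n σ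
  members σ = ⇔-sym (InB⇔wedge 1≤n) ⇔-∘ ∈-applyUpTo⇔ w
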